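{- The class of convex polyominoes equals $Av_{\mathfrak{P}}(H,V)$, where $H=\left[\begin{array}{ccc}1&0&1\end{array}\right]$ and $V=\left[\begin{array}{c}1\\0\\1\end{array}\right]$.
   Context: A polyomino is a finite edge-connected union of unit cells, identified with the binary matrix of its minimal bounding rectangle (entry $1$ iff the cell belongs to the polyomino). It is convex if each row and each column is connected. $Av_{\mathfrak{P}}(\mathcal{M})$ is the set of polyominoes whose matrix has no submatrix (obtained by deleting rows and/or columns) in $\mathcal{M}$. -}

module Defs where

open import Data.Nat using (ℕ; suc; _≥_)
open import Data.Bool using (Bool; true; false)
open import Data.Fin using (Fin; toℕ; zero; suc; _<_; _≤_)
open import Data.Product using (Σ; ∃; _×_; _,_)
open import Data.Sum using (_⊎_)
open import Relation.Binary.PropositionalEquality using (_≡_)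

-- A binary matrix with m rows and n columns (entry true = cell present).
BinMat : ℕ → ℕ → Set
BinMat m n = Fin m → Fin n → Bool

Succ : ∀ {k} → Fin k → Fin k → Set
Succ a b = suc (toℕ a) ≡ toℕ b

Adjacent : ∀ {m n} → Fin m × Fin n → Fin m × Fin n → Set
Adjacent (r , c) (r' , c') =
  (r ≡ r' × (Succ c c' ⊎ Succ c' c)) ⊎ (c ≡ c' × (Succ r r' ⊎ Succ r' r))

data Reach {m n} (M : BinMat m n) : Fin m × Fin n → Fin m × Fin n → Set where
  here : ∀ {r c} → M r c ≡ true → Reach M (r , c) (r , c)
  step : ∀ {x r c} → Reach M x (r , c) → ∀ {y} → Adjacent (r , c) y →
         (let (r' , c') = y in M r' c' ≡ true) → Reach M x y

-- The matrix of a polyomino: the filled cells are nonempty and edge-connected,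
-- and the rectangle is minimal bounding (every row and every column meets the set;
-- for a nonempty set this is exactly minimality of the bounding rectangle).
record IsPolyomino {m n} (M : BinMat m n) : Set where
  field
    rows-pos    : m ≥ 1
    cols-pos    : n ≥ 1
    row-hit     : ∀ r → ∃ λ c → M r c ≡ true
    col-hit     : ∀ c → ∃ λ r → M r c ≡ true
    connected   : ∀ r c r' c' → M r c ≡ true → M r' c' ≡ true → Reach M (r , c) (r' , c')

IsConvex : ∀ {m n} → BinMat m n → Set
IsConvex {m} {n} M =
  (∀ (r : Fin m) (c₁ c₂ c₃ : Fin n) → c₁ ≤ c₂ → c₂ ≤ c₃ →
     M r c₁ ≡ true → M r c₃ ≡ true → M r c₂ ≡ true)
  × (∀ (c : Fin n) (r₁ r₂ r₃ : Fin m) → r₁ ≤ r₂ → r₂ ≤ r₃ →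
     M r₁ c ≡ true → M r₃ c ≡ true → M r₂ c ≡ true)

StrictlyIncreasing : ∀ {k m} → (Fin k → Fin m) → Set
StrictlyIncreasing {k} f = ∀ (i j : Fin k) → i < j → f i < f j

Contains : ∀ {k l m n} → BinMat k l → BinMat m n → Set
Contains {k} {l} {m} {n} P M =
  Σ (Fin k → Fin m) λ f → Σ (Fin l → Fin n) λ g →
    StrictlyIncreasing f × StrictlyIncreasing g ×
    (∀ i j → M (f i) (g j) ≡ P i j)

H : BinMat 1 3
H _ zero = true
H _ (suc zero) = false
H _ (suc (suc zero)) = true

V : BinMat 3 1
V zero _ = true
V (suc zero) _ = false
V (suc (suc zero)) _ = true

module Submission where

-- The characterisation is a statement about single rows and columns, and it
-- holds for every binary matrix.
-- A Boolean sequence is an interval (its true entries are contiguous) iff it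
-- has no "gap": positions i < j < k carrying true, false, true.  A matrix
-- contains H iff one of its rows has a gap, since H's single row is exactly
-- a gap.  Hence "every row is an interval" is equivalent to avoiding H.
-- Columns are handled by transposition: convexity of M is row-convexity of
-- M and of its transpose, and M contains V iff its transpose contains H.

open import Defs
open import Data.Nat using (ℕ; z≤n; s≤s)
open import Data.Product using (_×_; ∃; _,_)
open import Relation.Nullary using (¬_)
open import Function.Bundles using (_⇔_; mk⇔; module Equivalence)

open import Data.Bool using (Bool; true; false)
open import Data.Fin using (Fin; zero; suc; _<_; _≤_)
open import Data.Fin.Properties using (≤∧≢⇒<; <-trans)
open import Data.Nat.Properties using (<⇒≤)
open import Data.Product.Function.NonDependent.Propositional using (_×-⇔_)
open import Data.Empty using (⊥-elim)
open import Function.Base using (_∘_)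
open import Function.Construct.Composition using (_⇔-∘_)
open import Relation.Nullary.Negation using (¬∃⟶∀¬; ∀¬⟶¬∃)
open import Relation.Binary.PropositionalEquality using (_≡_; _≢_; refl; sym; trans)

true≢false : true ≢ false
true≢false ()

valuesDiffer : ∀ {A : Set} (v : A → Bool) {a b : A} →
               v a ≡ true → v b ≡ false → a ≢ b
valuesDiffer v va vb refl = true≢false (trans (sym va) vb)

IsInterval : ∀ {n} → (Fin n → Bool) → Set
IsInterval {n} v = ∀ (c₁ c₂ c₃ : Fin n) → c₁ ≤ c₂ → c₂ ≤ c₃ →
                   v c₁ ≡ true → v c₃ ≡ true → v c₂ ≡ true

record Gap {n} (v : Fin n → Bool) : Set where
  constructor gap
  field
    {i j k} : Fin n
    i<j     : i < j
    j<k     : j < k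
    v-i     : v i ≡ true
    v-j     : v j ≡ false
    v-k     : v k ≡ true

interval⇒noGap : ∀ {n} {v : Fin n → Bool} → IsInterval v → ¬ Gap v
interval⇒noGap convex (gap i<j j<k v-i v-j v-k) =
  true≢false (trans (sym (convex _ _ _ (<⇒≤ i<j) (<⇒≤ j<k) v-i v-k)) v-j)

-- Conversely, a false entry between two true entries is strictly between
-- them (the values differ), so it witnesses a gap.
noGap⇒interval : ∀ {n} {v : Fin n → Bool} → ¬ Gap v → IsInterval v
noGap⇒interval {v = v} noGap c₁ c₂ c₃ c₁≤c₂ c₂≤c₃ v-c₁ v-c₃ with v c₂ in v-c₂
... | true  = refl
... | false = ⊥-elim (noGap (gap c₁<c₂ c₂<c₃ v-c₁ v-c₂ v-c₃))
  where
  c₁<c₂ : c₁ < c₂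
  c₁<c₂ = ≤∧≢⇒< c₁≤c₂ (valuesDiffer v v-c₁ v-c₂)
  c₂<c₃ : c₂ < c₃
  c₂<c₃ = ≤∧≢⇒< c₂≤c₃ (λ c₂≡c₃ → valuesDiffer v v-c₃ v-c₂ (sym c₂≡c₃))

triple : ∀ {n} → Fin n → Fin n → Fin n → Fin 3 → Fin n
triple a b c zero             = a
triple a b c (suc zero)       = b
triple a b c (suc (suc zero)) = c

triple-increasing : ∀ {n} {a b c : Fin n} → a < b → b < c →
                    StrictlyIncreasing (triple a b c)
triple-increasing a<b b<c zero             (suc zero)       _ = a<b
triple-increasing a<b b<c zero             (suc (suc zero)) _ = <-trans a<b b<c
triple-increasing a<b b<c (suc zero)       (suc (suc zero)) _ = b<c
triple-increasing a<b b<c zero             zero             ()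
triple-increasing a<b b<c (suc zero)       zero             ()
triple-increasing a<b b<c (suc zero)       (suc zero)       (s≤s ())
triple-increasing a<b b<c (suc (suc zero)) zero             ()
triple-increasing a<b b<c (suc (suc zero)) (suc zero)       (s≤s ())
triple-increasing a<b b<c (suc (suc zero)) (suc (suc zero)) (s≤s (s≤s ()))

single : ∀ {m} → Fin m → Fin 1 → Fin m
single r _ = r

single-increasing : ∀ {m} (r : Fin m) → StrictlyIncreasing (single r)
single-increasing r zero zero ()

containsH⇔rowGap : ∀ {m n} (M : BinMat m n) → Contains H M ⇔ ∃ λ r → Gap (M r)
containsH⇔rowGap M = mk⇔ toGap fromGap
  where
  toGap : Contains H M → ∃ λ r → Gap (M r)
  toGap (f , g , _ , g-inc , match) =
    f zero , gap (g-inc zero (suc zero) (s≤s z≤n))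
                 (g-inc (suc zero) (suc (suc zero)) (s≤s (s≤s z≤n)))
                 (match zero zero) (match zero (suc zero)) (match zero (suc (suc zero)))
  fromGap : (∃ λ r → Gap (M r)) → Contains H M
  fromGap (r , gap i<j j<k v-i v-j v-k) =
    single r , triple _ _ _ , single-increasing r , triple-increasing i<j j<k ,
    λ { zero zero → v-i ; zero (suc zero) → v-j ; zero (suc (suc zero)) → v-k }

RowConvex : ∀ {m n} → BinMat m n → Set
RowConvex {m} M = ∀ (r : Fin m) → IsInterval (M r)

rowConvex⇔avoidsH : ∀ {m n} (M : BinMat m n) → RowConvex M ⇔ (¬ Contains H M)
rowConvex⇔avoidsH M = mk⇔
  (λ convex → ∀¬⟶¬∃ (λ r → interval⇒noGap (convex r)) ∘ to)
  (λ avoidsH r → noGap⇒interval (¬∃⟶∀¬ (avoidsH ∘ from) r))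
  where open Equivalence (containsH⇔rowGap M)

transpose : ∀ {m n} → BinMat m n → BinMat n m
transpose M c r = M r c

contains-transpose : ∀ {k l m n} {P : BinMat k l} {M : BinMat m n} →
                     Contains P M → Contains (transpose P) (transpose M)
contains-transpose (f , g , f-inc , g-inc , match) =
  g , f , g-inc , f-inc , λ i j → match j i

contains-resp : ∀ {k l m n} {P Q : BinMat k l} {M : BinMat m n} →
                (∀ i j → P i j ≡ Q i j) → Contains P M → Contains Q M
contains-resp P≗Q (f , g , f-inc , g-inc , match) =
  f , g , f-inc , g-inc , λ i j → trans (match i j) (P≗Q i j)

transpose-H : ∀ i j → transpose H i j ≡ V i j
transpose-H zero             zero = refl
transpose-H (suc zero)       zero = refl
transpose-H (suc (suc zero)) zero = refl

transposeAvoidsH⇔avoidsV : ∀ {m n} (M : BinMat m n) →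
                           (¬ Contains H (transpose M)) ⇔ (¬ Contains V M)
transposeAvoidsH⇔avoidsV M = mk⇔ (_∘ V⇒Hᵀ) (_∘ Hᵀ⇒V)
  where
  V⇒Hᵀ : Contains V M → Contains H (transpose M)
  V⇒Hᵀ = contains-resp {M = transpose M} (λ i j → sym (transpose-H j i))
       ∘ contains-transpose {P = V} {M = M}
  Hᵀ⇒V : Contains H (transpose M) → Contains V M
  Hᵀ⇒V = contains-resp {M = M} transpose-H
       ∘ contains-transpose {P = H} {M = transpose M}

-- Convexity of M is definitionally row-convexity of M and of its transpose,
-- so the theorem is the row statement applied twice.
mainTheorem16 : ∀ (m n : ℕ) (M : BinMat m n) → IsPolyomino M →
    (IsConvex M ⇔ (¬ Contains H M × ¬ Contains V M))
mainTheorem16 m n M _ =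
  rowConvex⇔avoidsH M ×-⇔
  (transposeAvoidsH⇔avoidsV M ⇔-∘ rowConvex⇔avoidsH (transpose M))
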